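{- Let $r\ge 2$. Let $p_{n,\ell}^{(r)}$ be the total number of peaks at level $\ell+1$ over all paths in $\mathcal{A}_{n+1,0}^{(r)}$. Then for all integers $n\ge\ell\ge 0$, $$p_{n,\ell}^{(r)}=\sum_{j=0}^{n-\ell}\frac{2r(\ell+1)}{2n-j+2}\binom{2n-j+2}{n-\ell}\binom{n-\ell}{j}(r-1)^{n-j},$$ with $p_{0,0}^{(r)}=r$. Moreover, $p_{n,\ell}^{(r)}$ is the $(n,\ell)$-entry of the Riordan array $\left(rS_r(x)^2,\ x(r-1)S_r(x)^2\right)$, i.e. $p_{n,\ell}^{(r)}=[x^n]\,rS_r(x)^2\left(x(r-1)S_r(x)^2\right)^{\ell}$.
   Context: A Dyck path of length $2n$ is a lattice path from $(0,0)$ to $(2n,0)$ weakly above the $x$-axis with steps $\mathbf{u}=(1,1)$, $\mathbf{d}=(1,-1)$; an $r$-colored Dyck path has each $\mathbf{d}$-step colored with one of $r$ colors. $\mathcal{A}_{n,0}^{(r)}$ is the set of $r$-colored Dyck paths of length $2n$ with no two consecutive $\mathbf{d}$-steps of the same color. A peak is an occurrence of a $\mathbf{u}$-step immediately followed by a $\mathbf{d}$-step; its level is the ordinate of the common point of the two steps. $S_r(x)=\frac{1-x-\sqrt{(1-x)^2-4(r-1)x}}{2(r-1)x}$ is the unique power series with $S_r=1+xS_r+(r-1)xS_r^2$. A Riordan array $(d(x),h(x))$ is the matrix with $(n,k)$-entry $[x^n]d(x)h(x)^k$. -}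

module Defs where

open import Data.Bool using (Bool; true; false; _∧_; not; if_then_else_)
open import Data.Nat as ℕ using (ℕ; zero; suc; _∸_; _≡ᵇ_)
open import Data.Nat.Combinatorics using (_C_)
open import Data.Fin using (Fin)
open import Data.Fin.Properties using () renaming (_≟_ to _≟ᶠ_)
open import Data.List using (List; []; _∷_; map; concatMap; filterᵇ; upTo; foldr)
open import Data.Nat.ListAction using (sum)
open import Data.List.Base using (allFin)
open import Data.Integer as ℤ using (ℤ; +_)
open import Data.Rational as ℚ using (ℚ; _/_)
open import Relation.Nullary.Decidable using (⌊_⌋)
open import Relation.Binary.PropositionalEquality using (_≡_)

-- r-colored Dyck paths as words in the steps u and d_c (c : Fin r)

data Step (r : ℕ) : Set where
  U : Step r
  D : Fin r → Step r

steps : (r : ℕ) → List (Step r)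
steps r = U ∷ map D (allFin r)

words : (r k : ℕ) → List (List (Step r))
words r zero    = [] ∷ []
words r (suc k) = concatMap (λ w → map (_∷ w) (steps r)) (words r k)

dyckFrom : {r : ℕ} → ℕ → List (Step r) → Bool
dyckFrom h       []        = h ≡ᵇ 0
dyckFrom h       (U ∷ w)   = dyckFrom (suc h) w
dyckFrom zero    (D _ ∷ w) = false
dyckFrom (suc h) (D _ ∷ w) = dyckFrom h w

noSameDD : {r : ℕ} → List (Step r) → Bool
noSameDD (D c ∷ D c' ∷ w) = not ⌊ c ≟ᶠ c' ⌋ ∧ noSameDD (D c' ∷ w)
noSameDD (_ ∷ w)          = noSameDD w
noSameDD []               = true

-- membership test for A^{(r)}_{m,0} (given the word has length 2m)
inA : {r : ℕ} → List (Step r) → Bool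
inA w = dyckFrom 0 w ∧ noSameDD w

A : (r m : ℕ) → List (List (Step r))
A r m = filterᵇ inA (words r (2 ℕ.* m))

peaksAt : {r : ℕ} → (L h : ℕ) → List (Step r) → ℕ
peaksAt L h []              = 0
peaksAt L h (U ∷ D c ∷ w)   = (if suc h ≡ᵇ L then 1 else 0) ℕ.+ peaksAt L (suc h) (D c ∷ w)
peaksAt L h (U ∷ w)         = peaksAt L (suc h) w
peaksAt L h (D _ ∷ w)       = peaksAt L (h ∸ 1) w

p : (r n ℓ : ℕ) → ℕ
p r n ℓ = sum (map (peaksAt (suc ℓ) 0) (A r (suc n)))

sumℚ : List ℚ → ℚ
sumℚ = foldr ℚ._+_ ℚ.0ℚ

term : (r n ℓ j : ℕ) → ℚ
term r n ℓ j =
  ((+ (2 ℕ.* r ℕ.* suc ℓ)) / suc (suc (2 ℕ.* n ∸ j)))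
  ℚ.* ((+ ((suc (suc (2 ℕ.* n ∸ j)) C (n ∸ ℓ)) ℕ.* ((n ∸ ℓ) C j) ℕ.* ((r ∸ 1) ℕ.^ (n ∸ j)))) / 1)

formula : (r n ℓ : ℕ) → ℚ
formula r n ℓ = sumℚ (map (term r n ℓ) (upTo (suc (n ∸ ℓ))))

Series : Set
Series = ℕ → ℤ

sumℤ : List ℤ → ℤ
sumℤ = foldr ℤ._+_ (+ 0)

oneS : Series
oneS zero    = + 1
oneS (suc _) = + 0

xS : Series → Series
xS f zero    = + 0
xS f (suc n) = f n

scaleS : ℤ → Series → Series
scaleS a f n = a ℤ.* f n

_⊕_ : Series → Series → Series
(f ⊕ g) n = f n ℤ.+ g n

_⊛_ : Series → Series → Series
(f ⊛ g) n = sumℤ (map (λ i → f i ℤ.* g (n ∸ i)) (upTo (suc n)))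

powS : Series → ℕ → Series
powS f zero    = oneS
powS f (suc k) = f ⊛ powS f k

-- S satisfies S = 1 + x S + (r-1) x S^2 (this determines S_r(x) uniquely)
IsSr : ℕ → Series → Set
IsSr r S = ∀ n → S n ≡ (oneS ⊕ (xS S ⊕ scaleS (+ (r ∸ 1)) (xS (S ⊛ S)))) n

riordan : Series → Series → ℕ → ℕ → ℤ
riordan d h n k = (d ⊛ powS h k) n

{-# OPTIONS --safe #-}
-- Write R = r − 1 and S = 1 + x S + R x S². Splitting off the first step, the valid
-- continuations of a path after a down-step to height h, and their peaks at level ℓ + 1,
-- obey recursions in the length that are also obeyed by coefficients of powers of S: with
-- m up-steps left there are R^h [xᵐ] S^(h+1) such continuations, carrying
-- Σ_j (R + 1) R^(h+j) [xᵐ] x^(j+1) S^(h+2j+2) peaks (over j ≤ ℓ with ℓ − j ≤ h). For whole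
-- paths this gives p = (R + 1) R^ℓ [x^(n−ℓ)] S^(2ℓ+2), the Riordan entry; expanding powers
-- of S over forests of unary–binary trees and counting these by the cycle lemma gives the
-- binomial sum.
module Submission where

open import Data.Bool using (Bool; true; false; if_then_else_; _∧_; not)
open import Data.Fin as Fin using (Fin)
open import Data.Fin.Properties using () renaming (_≟_ to _≟ᶠ_)
import Data.Integer as ℤ
import Data.Integer.Properties as ℤ
open import Data.List using (List; []; _∷_; _++_; map; concatMap; filterᵇ; tabulate; allFin; upTo; applyUpTo)
import Data.List.Properties as List
open import Data.Nat hiding (_/_)
open import Data.Nat.Combinatorics using (_C_; nCk+nC[k+1]≡[n+1]C[k+1]; nC1≡n)
open import Data.Nat.ListAction using (sum)
open import Data.Nat.ListAction.Properties using (sum-++)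
open import Data.Nat.Properties
open import Algebra.Properties.CommutativeSemigroup +-commutativeSemigroup
  using () renaming (interchange to +-interchange)
open import Data.Nat.Tactic.RingSolver using (solve-∀)
open import Data.Product using (_×_; _,_)
import Data.Rational as ℚ
import Data.Rational.Properties as ℚ
import Data.Rational.Unnormalised as ℚᵘ
import Data.Rational.Unnormalised.Properties as ℚᵘ
open import Function using (_∘_)
open import Relation.Nullary.Decidable using (⌊_⌋; yes; no)
open import Relation.Binary.PropositionalEquality
open ≡-Reasoning
open import Defs

𝟙 : Bool → ℕ
𝟙 b = if b then 1 else 0

∑< : ℕ → (ℕ → ℕ) → ℕ
∑< zero    f = 0
∑< (suc n) f = f 0 + ∑< n (f ∘ suc)

syntax ∑< n (λ j → e) = ∑[ j < n ] e

∑<-cong : ∀ n {f g : ℕ → ℕ} → (∀ j → j < n → f j ≡ g j) → ∑< n f ≡ ∑< n g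
∑<-cong zero    f≗g = refl
∑<-cong (suc n) f≗g = cong₂ _+_ (f≗g 0 z<s) (∑<-cong n (λ j j<n → f≗g (suc j) (s<s j<n)))

∑<-+ : ∀ n (f g : ℕ → ℕ) → ∑[ j < n ] (f j + g j) ≡ ∑< n f + ∑< n g
∑<-+ zero    f g = refl
∑<-+ (suc n) f g = trans (cong (f 0 + g 0 +_) (∑<-+ n (f ∘ suc) (g ∘ suc)))
                         (+-interchange (f 0) (g 0) _ _)

∑<-*ˡ : ∀ n a (f : ℕ → ℕ) → ∑[ j < n ] (a * f j) ≡ a * ∑< n f
∑<-*ˡ zero    a f = sym (*-zeroʳ a)
∑<-*ˡ (suc n) a f = trans (cong (a * f 0 +_) (∑<-*ˡ n a (f ∘ suc))) (sym (*-distribˡ-+ a (f 0) _))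

∑<-last : ∀ n (f : ℕ → ℕ) → ∑< (suc n) f ≡ ∑< n f + f n
∑<-last zero    f = +-identityʳ (f 0)
∑<-last (suc n) f = trans (cong (f 0 +_) (∑<-last n (f ∘ suc))) (sym (+-assoc (f 0) _ _))

∑<-zero : ∀ n {f : ℕ → ℕ} → (∀ j → j < n → f j ≡ 0) → ∑< n f ≡ 0
∑<-zero zero    f≗0 = refl
∑<-zero (suc n) f≗0 = cong₂ _+_ (f≗0 0 z<s) (∑<-zero n (λ j j<n → f≗0 (suc j) (s<s j<n)))

∑⁺ : ℕ → (ℕ → ℕ → ℕ) → ℕ
∑⁺ zero    f = f 0 0
∑⁺ (suc m) f = f 0 (suc m) + ∑⁺ m (λ i j → f (suc i) j)

syntax ∑⁺ m (λ i j → e) = ∑[ i + j ≡ m ] e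

∑⁺-cong : ∀ m {f g : ℕ → ℕ → ℕ} → (∀ i j → i + j ≡ m → f i j ≡ g i j) →
          ∑⁺ m f ≡ ∑⁺ m g
∑⁺-cong zero    f≗g = f≗g 0 0 refl
∑⁺-cong (suc m) f≗g = cong₂ _+_ (f≗g 0 (suc m) refl) (∑⁺-cong m (λ i j eq → f≗g (suc i) j (cong suc eq)))

∑⁺-+ : ∀ m (f g : ℕ → ℕ → ℕ) → ∑[ i + j ≡ m ] (f i j + g i j) ≡ ∑⁺ m f + ∑⁺ m g
∑⁺-+ zero    f g = refl
∑⁺-+ (suc m) f g = trans (cong (f 0 (suc m) + g 0 (suc m) +_) (∑⁺-+ m _ _))
                         (+-interchange (f 0 (suc m)) (g 0 (suc m)) _ _)

∑⁺-*ˡ : ∀ m a (f : ℕ → ℕ → ℕ) → ∑[ i + j ≡ m ] (a * f i j) ≡ a * ∑⁺ m f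
∑⁺-*ˡ zero    a f = refl
∑⁺-*ˡ (suc m) a f = trans (cong (a * f 0 (suc m) +_) (∑⁺-*ˡ m a _)) (sym (*-distribˡ-+ a _ _))

∑⁺-zero : ∀ m {f : ℕ → ℕ → ℕ} → (∀ i j → f i j ≡ 0) → ∑⁺ m f ≡ 0
∑⁺-zero zero    f≗0 = f≗0 0 0
∑⁺-zero (suc m) f≗0 = cong₂ _+_ (f≗0 0 (suc m)) (∑⁺-zero m (λ i j → f≗0 (suc i) j))

∑⁺-last : ∀ m (f : ℕ → ℕ → ℕ) → ∑⁺ (suc m) f ≡ ∑[ i + j ≡ m ] f i (suc j) + f (suc m) 0
∑⁺-last zero    f = refl
∑⁺-last (suc m) f = trans (cong (f 0 (suc (suc m)) +_) (∑⁺-last m (λ i j → f (suc i) j)))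
                          (sym (+-assoc (f 0 (suc (suc m))) _ _))

applyUpTo-cong : ∀ {A : Set} n {f g : ℕ → A} → (∀ i → i < n → f i ≡ g i) → applyUpTo f n ≡ applyUpTo g n
applyUpTo-cong zero    f≗g = refl
applyUpTo-cong (suc n) f≗g = cong₂ _∷_ (f≗g 0 z<s) (applyUpTo-cong n (λ i i<n → f≗g (suc i) (s<s i<n)))

∑⁺-applyUpTo : ∀ m (f : ℕ → ℕ → ℕ) → sum (applyUpTo (λ i → f i (m ∸ i)) (suc m)) ≡ ∑⁺ m f
∑⁺-applyUpTo zero    f = +-identityʳ (f 0 0)
∑⁺-applyUpTo (suc m) f = cong (f 0 (suc m) +_) (∑⁺-applyUpTo m (λ i j → f (suc i) j))

sum-map-+ : ∀ {A : Set} (xs : List A) (f g : A → ℕ) →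
            sum (map (λ x → f x + g x) xs) ≡ sum (map f xs) + sum (map g xs)
sum-map-+ []       f g = refl
sum-map-+ (x ∷ xs) f g = trans (cong (f x + g x +_) (sum-map-+ xs f g)) (+-interchange (f x) (g x) _ _)

sum-map-*ˡ : ∀ {A : Set} (xs : List A) a (f : A → ℕ) → sum (map (λ x → a * f x) xs) ≡ a * sum (map f xs)
sum-map-*ˡ []       a f = sym (*-zeroʳ a)
sum-map-*ˡ (x ∷ xs) a f = trans (cong (a * f x +_) (sum-map-*ˡ xs a f)) (sym (*-distribˡ-+ a (f x) _))

sum-map-zero : ∀ {A : Set} (xs : List A) {f : A → ℕ} → (∀ x → f x ≡ 0) → sum (map f xs) ≡ 0
sum-map-zero []       f≗0 = refl
sum-map-zero (x ∷ xs) f≗0 = cong₂ _+_ (f≗0 x) (sum-map-zero xs f≗0)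

sum-map-concatMap : ∀ {A B : Set} (xs : List B) (g : B → List A) (f : A → ℕ) →
                    sum (map f (concatMap g xs)) ≡ sum (map (λ x → sum (map f (g x))) xs)
sum-map-concatMap []       g f = refl
sum-map-concatMap (x ∷ xs) g f = begin
  sum (map f (g x ++ concatMap g xs))           ≡⟨ cong sum (List.map-++ f (g x) (concatMap g xs)) ⟩
  sum (map f (g x) ++ map f (concatMap g xs))   ≡⟨ sum-++ (map f (g x)) _ ⟩
  sum (map f (g x)) + sum (map f (concatMap g xs)) ≡⟨ cong (sum (map f (g x)) +_) (sum-map-concatMap xs g f) ⟩
  sum (map f (g x)) + sum (map (λ x → sum (map f (g x))) xs) ∎

sum-map-swap : ∀ {A B : Set} (xs : List A) (ys : List B) (f : A → B → ℕ) →
               sum (map (λ x → sum (map (f x) ys)) xs) ≡ sum (map (λ y → sum (map (λ x → f x y) xs)) ys)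
sum-map-swap []       ys f = sym (sum-map-zero ys (λ _ → refl))
sum-map-swap (x ∷ xs) ys f = trans (cong (sum (map (f x) ys) +_) (sum-map-swap xs ys f))
                                   (sym (sum-map-+ ys (f x) (λ y → sum (map (λ x → f x y) xs))))

sum-map-filterᵇ : ∀ {A : Set} (P : A → Bool) (f : A → ℕ) (xs : List A) →
                  sum (map f (filterᵇ P xs)) ≡ sum (map (λ x → 𝟙 (P x) * f x) xs)
sum-map-filterᵇ P f []       = refl
sum-map-filterᵇ P f (x ∷ xs) with P x
... | true  = cong₂ _+_ (sym (+-identityʳ (f x))) (sum-map-filterᵇ P f xs)
... | false = sum-map-filterᵇ P f xs

sum-tabulate-const : ∀ n x → sum (tabulate {n = n} (λ _ → x)) ≡ n * x
sum-tabulate-const zero    x = refl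
sum-tabulate-const (suc n) x = cong (x +_) (sum-tabulate-const n x)

distinct : ∀ {n} → Fin n → Fin n → ℕ
distinct c c′ = 𝟙 (not ⌊ c ≟ᶠ c′ ⌋)

sum-tabulate-distinct : ∀ n (c : Fin (suc n)) x → sum (tabulate (λ c′ → distinct c c′ * x)) ≡ n * x
sum-tabulate-distinct n       Fin.zero    x =
  trans (cong sum (List.tabulate-cong {n = n} (λ _ → *-identityˡ x))) (sum-tabulate-const n x)
sum-tabulate-distinct (suc n) (Fin.suc c) x = cong₂ _+_ (*-identityˡ x)
  (trans (cong sum (List.tabulate-cong (λ c′ → cong (λ b → 𝟙 (not b) * x) (suc-≟-suc c c′))))
         (sum-tabulate-distinct n c x))
  where
  suc-≟-suc : ∀ {n} (c c′ : Fin n) → ⌊ Fin.suc c ≟ᶠ Fin.suc c′ ⌋ ≡ ⌊ c ≟ᶠ c′ ⌋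
  suc-≟-suc c c′ with c ≟ᶠ c′
  ... | yes _ = refl
  ... | no  _ = refl

𝟙-∧-∧ : ∀ a b c → 𝟙 (a ∧ (b ∧ c)) ≡ 𝟙 b * 𝟙 (a ∧ c)
𝟙-∧-∧ true  true  c = sym (+-identityʳ _)
𝟙-∧-∧ true  false c = refl
𝟙-∧-∧ false true  c = refl
𝟙-∧-∧ false false c = refl

<ᵇ-suc : ∀ m n → (m <ᵇ suc n) ≡ (m ≤ᵇ n)
<ᵇ-suc zero    n = refl
<ᵇ-suc (suc m) n = refl

≤ᵇ-refl : ∀ n → (n ≤ᵇ n) ≡ true
≤ᵇ-refl zero    = refl
≤ᵇ-refl (suc n) = trans (<ᵇ-suc n n) (≤ᵇ-refl n)

≤ᵇ-< : ∀ {m n} → n < m → (m ≤ᵇ n) ≡ false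
≤ᵇ-< {suc m} {zero}  _         = refl
≤ᵇ-< {suc m} {suc n} (s<s n<m) = trans (<ᵇ-suc m n) (≤ᵇ-< n<m)

≡ᵇ-< : ∀ {m n} → n < m → (m ≡ᵇ n) ≡ false
≡ᵇ-< {suc m} {zero}  _         = refl
≡ᵇ-< {suc m} {suc n} (s<s n<m) = ≡ᵇ-< n<m

𝟙-≤ᵇ-split : ∀ m n → 𝟙 (m ≤ᵇ n) ≡ 𝟙 (n ≡ᵇ m) + 𝟙 (suc m ≤ᵇ n)
𝟙-≤ᵇ-split zero    zero    = refl
𝟙-≤ᵇ-split zero    (suc n) = refl
𝟙-≤ᵇ-split (suc m) zero    = refl
𝟙-≤ᵇ-split (suc m) (suc n) = trans (cong 𝟙 (<ᵇ-suc m n)) (𝟙-≤ᵇ-split m n)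

absorption : ∀ n k → suc k * (suc n C suc k) ≡ suc n * (n C k)
absorption zero    zero    = refl
absorption zero    (suc k) = *-zeroʳ (suc (suc k))
absorption (suc n) zero    = trans (*-identityˡ _) (trans (nC1≡n (suc (suc n))) (sym (*-identityʳ _)))
absorption (suc n) (suc k) = begin
  suc (suc k) * (suc (suc n) C suc (suc k))
    ≡⟨ cong (suc (suc k) *_) (sym (nCk+nC[k+1]≡[n+1]C[k+1] (suc n) (suc k))) ⟩
  suc (suc k) * (suc n C suc k + suc n C suc (suc k))
    ≡⟨ split (suc k) (suc n C suc k) _ ⟩
  suc k * (suc n C suc k) + suc n C suc k + suc (suc k) * (suc n C suc (suc k))
    ≡⟨ cong₂ (λ x y → x + suc n C suc k + y) (absorption n k) (absorption n (suc k)) ⟩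
  suc n * (n C k) + suc n C suc k + suc n * (n C suc k)
    ≡⟨ join (suc n) (n C k) (suc n C suc k) _ ⟩
  suc n * (n C k + n C suc k) + suc n C suc k
    ≡⟨ cong (λ x → suc n * x + suc n C suc k) (nCk+nC[k+1]≡[n+1]C[k+1] n k) ⟩
  suc n * (suc n C suc k) + suc n C suc k
    ≡⟨ +-comm (suc n * (suc n C suc k)) _ ⟩
  suc (suc n) * (suc n C suc k) ∎
  where
  split : ∀ a x y → suc a * (x + y) ≡ a * x + x + suc a * y
  split = solve-∀
  join : ∀ a x y z → a * x + y + a * z ≡ a * (x + z) + y
  join = solve-∀

absorption-complement : ∀ p s → suc p * (suc (p + s) C s) ≡ suc (p + s) * ((p + s) C s)
absorption-complement p zero    = cong (λ x → suc x * 1) (sym (+-identityʳ p))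
absorption-complement p (suc s) = begin
  suc p * (suc (p + suc s) C suc s)
    ≡⟨ cong (λ x → suc p * (suc x C suc s)) (+-suc p s) ⟩
  suc p * (suc (suc (p + s)) C suc s)
    ≡⟨ cong (suc p *_) (sym (nCk+nC[k+1]≡[n+1]C[k+1] (suc (p + s)) s)) ⟩
  suc p * (suc (p + s) C s + suc (p + s) C suc s)
    ≡⟨ *-distribˡ-+ (suc p) (suc (p + s) C s) (suc (p + s) C suc s) ⟩
  suc p * (suc (p + s) C s) + suc p * (suc (p + s) C suc s)
    ≡⟨ cong (_+ suc p * (suc (p + s) C suc s)) (trans (absorption-complement p s) (sym (absorption (p + s) s))) ⟩
  suc s * (suc (p + s) C suc s) + suc p * (suc (p + s) C suc s)
    ≡⟨ sym (*-distribʳ-+ _ (suc s) (suc p)) ⟩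
  (suc s + suc p) * (suc (p + s) C suc s)
    ≡⟨ cong₂ _*_ (reorder p s) (cong (_C suc s) (sym (+-suc p s))) ⟩
  suc (p + suc s) * ((p + suc s) C suc s) ∎
  where
  reorder : ∀ p s → suc s + suc p ≡ suc (p + suc s)
  reorder = solve-∀

trinomial : ℕ → ℕ → ℕ → ℕ
trinomial x y z = ((x + (y + z)) C (y + z)) * ((y + z) C y)

trinomial-absorbˣ : ∀ x y z → suc x * trinomial (suc x) y z ≡ suc (x + (y + z)) * trinomial x y z
trinomial-absorbˣ x y z = begin
  suc x * ((suc (x + (y + z)) C (y + z)) * ((y + z) C y))
    ≡⟨ *-assoc (suc x) (suc (x + (y + z)) C (y + z)) ((y + z) C y) ⟨
  suc x * (suc (x + (y + z)) C (y + z)) * ((y + z) C y)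
    ≡⟨ cong (_* ((y + z) C y)) (absorption-complement x (y + z)) ⟩
  suc (x + (y + z)) * ((x + (y + z)) C (y + z)) * ((y + z) C y)
    ≡⟨ *-assoc (suc (x + (y + z))) ((x + (y + z)) C (y + z)) ((y + z) C y) ⟩
  suc (x + (y + z)) * trinomial x y z ∎

private
  absorb-outer : ∀ n s t → (suc n C suc s) * (suc s * t) ≡ suc n * ((n C s) * t)
  absorb-outer n s t = begin
    (suc n C suc s) * (suc s * t) ≡⟨ *-assoc (suc n C suc s) (suc s) t ⟨
    (suc n C suc s) * suc s * t   ≡⟨ cong (λ u → u * t) (trans (*-comm (suc n C suc s) (suc s)) (absorption n s)) ⟩
    suc n * (n C s) * t           ≡⟨ *-assoc (suc n) (n C s) t ⟩
    suc n * ((n C s) * t)         ∎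

  swap-left : ∀ a b c → a * (b * c) ≡ b * (a * c)
  swap-left = solve-∀

  size : ∀ a j k → a + j + (k + k) ≡ a + k + (j + k)
  size = solve-∀

  vanishing : ∀ n m b t → n * (m * 0) ≡ b * 0 * t
  vanishing = solve-∀

  rooted : ∀ {N M f} b T₀ x T₁ → N ≡ M → N * f ≡ b * T₀ → suc x * T₁ ≡ suc M * T₀ →
           suc N * (N * f) ≡ b * suc x * T₁
  rooted {N} {M} {f} b T₀ x T₁ refl IH absorb = begin
    suc N * (N * f)     ≡⟨ cong (suc N *_) IH ⟩
    suc N * (b * T₀)    ≡⟨ swap-left (suc N) b T₀ ⟩
    b * (suc N * T₀)    ≡⟨ cong (b *_) absorb ⟨
    b * (suc x * T₁)    ≡⟨ *-assoc b (suc x) T₁ ⟨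
    b * suc x * T₁      ∎

trinomial-absorbʸ : ∀ x y z → suc y * trinomial x (suc y) z ≡ suc (x + (y + z)) * trinomial x y z
trinomial-absorbʸ x y z = begin
  suc y * (((x + suc (y + z)) C suc (y + z)) * (suc (y + z) C suc y))
    ≡⟨ cong (λ n → suc y * ((n C suc (y + z)) * (suc (y + z) C suc y))) (+-suc x (y + z)) ⟩
  suc y * ((suc (x + (y + z)) C suc (y + z)) * (suc (y + z) C suc y))
    ≡⟨ swap-left (suc y) (suc (x + (y + z)) C suc (y + z)) (suc (y + z) C suc y) ⟩
  (suc (x + (y + z)) C suc (y + z)) * (suc y * (suc (y + z) C suc y))
    ≡⟨ cong ((suc (x + (y + z)) C suc (y + z)) *_) (absorption (y + z) y) ⟩
  (suc (x + (y + z)) C suc (y + z)) * (suc (y + z) * ((y + z) C y))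
    ≡⟨ absorb-outer (x + (y + z)) (y + z) ((y + z) C y) ⟩
  suc (x + (y + z)) * trinomial x y z ∎

trinomial-absorbᶻ : ∀ x y z → suc z * trinomial x y (suc z) ≡ suc (x + (y + z)) * trinomial x y z
trinomial-absorbᶻ x y z = begin
  suc z * (((x + (y + suc z)) C (y + suc z)) * ((y + suc z) C y))
    ≡⟨ cong (λ s → suc z * (((x + s) C s) * (s C y))) (+-suc y z) ⟩
  suc z * (((x + suc (y + z)) C suc (y + z)) * (suc (y + z) C y))
    ≡⟨ cong (λ n → suc z * ((n C suc (y + z)) * (suc (y + z) C y))) (+-suc x (y + z)) ⟩
  suc z * ((suc (x + (y + z)) C suc (y + z)) * (suc (y + z) C y))
    ≡⟨ swap-left (suc z) (suc (x + (y + z)) C suc (y + z)) (suc (y + z) C y) ⟩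
  (suc (x + (y + z)) C suc (y + z)) * (suc z * (suc (y + z) C y))
    ≡⟨ cong (λ t → (suc (x + (y + z)) C suc (y + z)) * t) inner ⟩
  (suc (x + (y + z)) C suc (y + z)) * (suc (y + z) * ((y + z) C y))
    ≡⟨ absorb-outer (x + (y + z)) (y + z) ((y + z) C y) ⟩
  suc (x + (y + z)) * trinomial x y z ∎
  where
  inner : suc z * (suc (y + z) C y) ≡ suc (y + z) * ((y + z) C y)
  inner = subst (λ s → suc z * (suc s C y) ≡ suc s * (s C y)) (+-comm z y) (absorption-complement z y)

-- forests a j k counts ordered forests of a plane trees whose nodes have at most two
-- children, with j unary and k binary nodes; the recursion classifies the first root.
mutual
  forests : ℕ → ℕ → ℕ → ℕ
  forests zero    zero    zero    = 1
  forests zero    zero    (suc k) = 0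
  forests zero    (suc j) k       = 0
  forests (suc a) j       k       = forests a j k + unaryRooted a j k + binaryRooted a j k

  unaryRooted : ℕ → ℕ → ℕ → ℕ
  unaryRooted a zero    k = 0
  unaryRooted a (suc j) k = forests (suc a) j k

  binaryRooted : ℕ → ℕ → ℕ → ℕ
  binaryRooted a j zero    = 0
  binaryRooted a j (suc k) = forests (suc (suc a)) j k

forests-0-0 : ∀ a → forests a 0 0 ≡ 1
forests-0-0 zero    = refl
forests-0-0 (suc a) = trans (+-identityʳ _) (trans (+-identityʳ _) (forests-0-0 a))

-- The cycle lemma: a forest with N = a + j + 2k nodes corresponds to a/N of the
-- arrangements of its a + k leaves, j unary and k binary nodes.
mutual
  forests-closed : ∀ a j k → (a + j + (k + k)) * forests a j k ≡ a * trinomial (a + k) j k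
  forests-closed zero          zero    zero    = refl
  forests-closed zero          zero    (suc k) = *-zeroʳ (suc k + suc k)
  forests-closed zero          (suc j) k       = *-zeroʳ (suc j + (k + k))
  forests-closed (suc zero)    zero    zero    = refl
  forests-closed (suc zero)    zero    (suc k) = forests-closed-suc 0 0 (suc k)
  forests-closed (suc zero)    (suc j) k       = forests-closed-suc 0 (suc j) k
  forests-closed (suc (suc a)) j       k       = forests-closed-suc (suc a) j k

  forests-closed-suc : ∀ a j k → .{{NonZero (a + j + (k + k))}} →
    suc (a + j + (k + k)) * forests (suc a) j k ≡ suc a * trinomial (suc a + k) j k
  forests-closed-suc a j k = *-cancelˡ-≡ _ _ N (begin
    N * (suc N * (forests a j k + unaryRooted a j k + binaryRooted a j k))
      ≡⟨ expand N (forests a j k) (unaryRooted a j k) (binaryRooted a j k) ⟩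
    suc N * (N * forests a j k) + suc N * (N * unaryRooted a j k) + suc N * (N * binaryRooted a j k)
      ≡⟨ cong₂ _+_ (cong₂ _+_ leafRooted (unaryRooted-closed a j k)) (binaryRooted-closed a j k) ⟩
    a * suc (a + k) * T + suc a * j * T + suc (suc a) * k * T
      ≡⟨ collect a j k T ⟩
    N * (suc a * T) ∎)
    where
    N T : ℕ
    N = a + j + (k + k)
    T = trinomial (suc a + k) j k
    expand : ∀ n x y z → n * (suc n * (x + y + z)) ≡ suc n * (n * x) + suc n * (n * y) + suc n * (n * z)
    expand = solve-∀
    collect : ∀ a j k t → a * suc (a + k) * t + suc a * j * t + suc (suc a) * k * t ≡ (a + j + (k + k)) * (suc a * t)
    collect = solve-∀
    leafRooted : suc N * (N * forests a j k) ≡ a * suc (a + k) * T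
    leafRooted = begin
      suc N * (N * forests a j k)            ≡⟨ cong (suc N *_) (forests-closed a j k) ⟩
      suc N * (a * trinomial (a + k) j k)   ≡⟨ swap-left (suc N) a _ ⟩
      a * (suc N * trinomial (a + k) j k)   ≡⟨ cong (λ n → a * (suc n * trinomial (a + k) j k)) (size a j k) ⟩
      a * (suc (a + k + (j + k)) * trinomial (a + k) j k) ≡⟨ cong (a *_) (trinomial-absorbˣ (a + k) j k) ⟨
      a * (suc (a + k) * T)                 ≡⟨ *-assoc a (suc (a + k)) T ⟨
      a * suc (a + k) * T                   ∎

  unaryRooted-closed : ∀ a j k →
    suc (a + j + (k + k)) * ((a + j + (k + k)) * unaryRooted a j k) ≡ suc a * j * trinomial (suc a + k) j k
  unaryRooted-closed a zero    k =
    vanishing (suc (a + 0 + (k + k))) (a + 0 + (k + k)) (suc a) (trinomial (suc a + k) 0 k)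
  unaryRooted-closed a (suc j) k =
    rooted (suc a) (trinomial (suc a + k) j k) j (trinomial (suc a + k) (suc j) k)
      (trans shift (size (suc a) j k))
      (trans (cong (_* forests (suc a) j k) shift) (forests-closed (suc a) j k))
      (trinomial-absorbʸ (suc a + k) j k)
    where shift : a + suc j + (k + k) ≡ suc a + j + (k + k)
          shift = cong (_+ (k + k)) (+-suc a j)

  binaryRooted-closed : ∀ a j k →
    suc (a + j + (k + k)) * ((a + j + (k + k)) * binaryRooted a j k) ≡ suc (suc a) * k * trinomial (suc a + k) j k
  binaryRooted-closed a j zero    =
    vanishing (suc (a + j + 0)) (a + j + 0) (suc (suc a)) (trinomial (suc a + 0) j 0)
  binaryRooted-closed a j (suc k) =
    rooted (suc (suc a)) (trinomial (suc (suc a) + k) j k) k (trinomial (suc a + suc k) j (suc k))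
      (trans (shift a j k) (size (suc (suc a)) j k))
      (trans (cong (_* forests (suc (suc a)) j k) (shift a j k)) (forests-closed (suc (suc a)) j k))
      (trans (cong (λ x → suc k * trinomial (suc x) j (suc k)) (+-suc a k)) (trinomial-absorbᶻ (suc (suc a) + k) j k))
    where shift : ∀ a j k → a + j + (suc k + suc k) ≡ suc (suc a) + j + (k + k)
          shift = solve-∀

module Coefficients (R : ℕ) where

  -- coeff a m = [xᵐ] Sᵃ for S = 1 + x S + R x S², using Sᵃ⁺¹ = Sᵃ + x Sᵃ⁺¹ + R x Sᵃ⁺².
  coeff : ℕ → ℕ → ℕ
  coeff a       zero    = 1
  coeff zero    (suc m) = 0
  coeff (suc a) (suc m) = coeff a (suc m) + coeff (suc a) m + R * coeff (suc (suc a)) m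

  coeff-forests : ∀ a m → coeff a m ≡ ∑[ j + k ≡ m ] (forests a j k * R ^ k)
  coeff-forests zero    zero    = refl
  coeff-forests (suc a) zero    = sym (trans (*-identityʳ _) (forests-0-0 (suc a)))
  coeff-forests zero    (suc m) = sym (∑⁺-zero m (λ _ _ → refl))
  coeff-forests (suc a) (suc m) = begin
    coeff a (suc m) + coeff (suc a) m + R * coeff (suc (suc a)) m
      ≡⟨ cong₂ _+_ (cong₂ _+_ (coeff-forests a (suc m)) (coeff-forests (suc a) m))
                   (cong (R *_) (coeff-forests (suc (suc a)) m)) ⟩
    ∑⁺ (suc m) φ + ∑⁺ m (λ j k → forests (suc a) j k * R ^ k) + R * F (suc (suc a)) m
      ≡⟨ cong (∑⁺ (suc m) φ + ∑⁺ (suc m) υ +_) binaryRooted-sum ⟨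
    ∑⁺ (suc m) φ + ∑⁺ (suc m) υ + ∑⁺ (suc m) β
      ≡⟨ cong (_+ ∑⁺ (suc m) β) (∑⁺-+ (suc m) φ υ) ⟨
    ∑[ j + k ≡ suc m ] (φ j k + υ j k) + ∑⁺ (suc m) β
      ≡⟨ ∑⁺-+ (suc m) (λ j k → φ j k + υ j k) β ⟨
    ∑[ j + k ≡ suc m ] (φ j k + υ j k + β j k)
      ≡⟨ ∑⁺-cong (suc m) (λ j k _ → collect (forests a j k) (unaryRooted a j k) (binaryRooted a j k) (R ^ k)) ⟩
    F (suc a) (suc m) ∎
    where
    F : ℕ → ℕ → ℕ
    F a m = ∑[ j + k ≡ m ] (forests a j k * R ^ k)
    φ υ β : ℕ → ℕ → ℕ
    φ j k = forests a j k * R ^ k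
    υ j k = unaryRooted a j k * R ^ k
    β j k = binaryRooted a j k * R ^ k
    collect : ∀ x y z w → x * w + y * w + z * w ≡ (x + y + z) * w
    collect = solve-∀
    binaryRooted-sum : ∑⁺ (suc m) β ≡ R * F (suc (suc a)) m
    binaryRooted-sum = begin
      ∑⁺ (suc m) β
        ≡⟨ ∑⁺-last m β ⟩
      ∑[ j + k ≡ m ] (forests (suc (suc a)) j k * (R * R ^ k)) + 0
        ≡⟨ +-identityʳ _ ⟩
      ∑[ j + k ≡ m ] (forests (suc (suc a)) j k * (R * R ^ k))
        ≡⟨ ∑⁺-cong m (λ j k _ → x∙yz≈y∙xz (forests (suc (suc a)) j k) R (R ^ k)) ⟩
      ∑[ j + k ≡ m ] (R * (forests (suc (suc a)) j k * R ^ k))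
        ≡⟨ ∑⁺-*ˡ m R (λ j k → forests (suc (suc a)) j k * R ^ k) ⟩
      R * F (suc (suc a)) m ∎
      where x∙yz≈y∙xz : ∀ x y z → x * (y * z) ≡ y * (x * z)
            x∙yz≈y∙xz = solve-∀

  coeff-convolution : ∀ m a b → ∑[ i + j ≡ m ] (coeff a i * coeff b j) ≡ coeff (a + b) m
  coeff-convolution zero    a       b = refl
  coeff-convolution (suc m) zero    b =
    trans (cong (coeff b (suc m) + 0 +_) (∑⁺-zero m (λ _ _ → refl))) (trans (+-identityʳ _) (+-identityʳ _))
  coeff-convolution (suc m) (suc a) b = begin
    1 * coeff b (suc m) + ∑[ i + j ≡ m ] (coeff (suc a) (suc i) * coeff b j)
      ≡⟨ cong (1 * coeff b (suc m) +_) split ⟩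
    1 * coeff b (suc m) + (∑⁺ m P + ∑⁺ m Q + R * ∑⁺ m W)
      ≡⟨ regroup (1 * coeff b (suc m)) (∑⁺ m P) (∑⁺ m Q) (R * ∑⁺ m W) ⟩
    ∑[ i + j ≡ suc m ] (coeff a i * coeff b j) + ∑⁺ m Q + R * ∑⁺ m W
      ≡⟨ cong₂ _+_ (cong₂ _+_ (coeff-convolution (suc m) a b) (coeff-convolution m (suc a) b))
                   (cong (R *_) (coeff-convolution m (suc (suc a)) b)) ⟩
    coeff (suc a + b) (suc m) ∎
    where
    P Q W : ℕ → ℕ → ℕ
    P i j = coeff a (suc i) * coeff b j
    Q i j = coeff (suc a) i * coeff b j
    W i j = coeff (suc (suc a)) i * coeff b j
    distrib : ∀ r x y z w → (x + y + r * z) * w ≡ x * w + y * w + r * (z * w)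
    distrib = solve-∀
    regroup : ∀ a b c d → a + (b + c + d) ≡ a + b + c + d
    regroup = solve-∀
    split : ∑[ i + j ≡ m ] (coeff (suc a) (suc i) * coeff b j) ≡ ∑⁺ m P + ∑⁺ m Q + R * ∑⁺ m W
    split = begin
      ∑[ i + j ≡ m ] (coeff (suc a) (suc i) * coeff b j)
        ≡⟨ ∑⁺-cong m (λ i j _ → distrib R (coeff a (suc i)) (coeff (suc a) i)
                                             (coeff (suc (suc a)) i) (coeff b j)) ⟩
      ∑[ i + j ≡ m ] (P i j + Q i j + R * W i j)
        ≡⟨ ∑⁺-+ m (λ i j → P i j + Q i j) (λ i j → R * W i j) ⟩
      ∑[ i + j ≡ m ] (P i j + Q i j) + ∑[ i + j ≡ m ] (R * W i j)
        ≡⟨ cong₂ _+_ (∑⁺-+ m P Q) (∑⁺-*ˡ m R W) ⟩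
      ∑⁺ m P + ∑⁺ m Q + R * ∑⁺ m W ∎

  -- coeffˣ J a m = [xᵐ] xᴶ Sᵃ
  coeffˣ : ℕ → ℕ → ℕ → ℕ
  coeffˣ zero    a m       = coeff a m
  coeffˣ (suc J) a zero    = 0
  coeffˣ (suc J) a (suc m) = coeffˣ J a m

  coeffˣ-offset : ∀ J a m → coeffˣ J a (J + m) ≡ coeff a m
  coeffˣ-offset zero    a m = refl
  coeffˣ-offset (suc J) a m = coeffˣ-offset J a m

  coeffˣ-rec : ∀ J a m →
    coeffˣ J (suc a) (suc m) ≡ coeffˣ J a (suc m) + coeffˣ J (suc a) m + R * coeffˣ J (suc (suc a)) m
  coeffˣ-rec zero          a m       = refl
  coeffˣ-rec (suc zero)    a zero    = cong suc (sym (*-zeroʳ R))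
  coeffˣ-rec (suc (suc J)) a zero    = sym (*-zeroʳ R)
  coeffˣ-rec (suc J)       a (suc m) = coeffˣ-rec J a m

  coeffˣ-convolution : ∀ J m a b → ∑[ i + j ≡ m ] (coeff a i * coeffˣ J b j) ≡ coeffˣ J (a + b) m
  coeffˣ-convolution zero    m       a b = coeff-convolution m a b
  coeffˣ-convolution (suc J) zero    a b = refl
  coeffˣ-convolution (suc J) (suc m) a b = begin
    ∑[ i + j ≡ suc m ] (coeff a i * coeffˣ (suc J) b j)
      ≡⟨ ∑⁺-last m (λ i j → coeff a i * coeffˣ (suc J) b j) ⟩
    ∑[ i + j ≡ m ] (coeff a i * coeffˣ J b j) + coeff a (suc m) * 0
      ≡⟨ cong (∑[ i + j ≡ m ] (coeff a i * coeffˣ J b j) +_) (*-zeroʳ (coeff a (suc m))) ⟩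
    ∑[ i + j ≡ m ] (coeff a i * coeffˣ J b j) + 0
      ≡⟨ +-identityʳ _ ⟩
    ∑[ i + j ≡ m ] (coeff a i * coeffˣ J b j)
      ≡⟨ coeffˣ-convolution J m a b ⟩
    coeffˣ J (a + b) m ∎

  scaled-convolution : ∀ s t ℓ b m →
    ∑[ i + j ≡ m ] (s * coeff 2 i * (t * coeffˣ ℓ b j)) ≡ s * t * coeffˣ ℓ (2 + b) m
  scaled-convolution s t ℓ b m = begin
    ∑[ i + j ≡ m ] (s * coeff 2 i * (t * coeffˣ ℓ b j))
      ≡⟨ ∑⁺-cong m (λ i j _ → interchange s (coeff 2 i) t (coeffˣ ℓ b j)) ⟩
    ∑[ i + j ≡ m ] (s * t * (coeff 2 i * coeffˣ ℓ b j))
      ≡⟨ ∑⁺-*ˡ m (s * t) (λ i j → coeff 2 i * coeffˣ ℓ b j) ⟩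
    s * t * ∑[ i + j ≡ m ] (coeff 2 i * coeffˣ ℓ b j)
      ≡⟨ cong (s * t *_) (coeffˣ-convolution ℓ m 2 b) ⟩
    s * t * coeffˣ ℓ (2 + b) m ∎
    where interchange : ∀ a b c d → a * b * (c * d) ≡ a * c * (b * d)
          interchange = solve-∀

  -- [xⁿ] (R + 1) S² (x R S²)^ℓ
  riordanEntry : ℕ → ℕ → ℕ
  riordanEntry ℓ n = suc R * R ^ ℓ * coeffˣ ℓ (suc (suc (ℓ + ℓ))) n

module ClosedForms (R ℓ : ℕ) where
  open Coefficients R

  ascend : (ℕ → ℕ → ℕ) → ℕ → ℕ → ℕ
  ascend u h zero    = 0
  ascend u h (suc m) = u (suc h) m

  downCount : ℕ → ℕ → ℕ
  downCount h m = R ^ h * coeff (suc h) m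

  upCount : ℕ → ℕ → ℕ
  upCount h m = downCount (suc h) m + downCount h m

  downCount-zero-suc : ∀ m → downCount 0 (suc m) ≡ upCount 0 m
  downCount-zero-suc m = shuffle R (coeff 1 m) (coeff 2 m)
    where shuffle : ∀ r x y → 1 * (x + r * y) ≡ r * 1 * y + 1 * x
          shuffle = solve-∀

  downCount-suc : ∀ h m → downCount (suc h) m ≡ ascend upCount h m + R * downCount h m
  downCount-suc h zero    = *-assoc R (R ^ h) 1
  downCount-suc h (suc m) = shuffle R (R ^ h) (coeff (suc h) (suc m)) (coeff (suc (suc h)) m) (coeff (suc (suc (suc h))) m)
    where shuffle : ∀ r p x y z → r * p * (x + y + r * z) ≡ r * (r * p) * z + r * p * y + r * (p * x)
          shuffle = solve-∀

  upCount-rec : ∀ h m → upCount h m ≡ ascend upCount h m + suc R * downCount h m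
  upCount-rec h m = trans (cong (_+ downCount h m) (downCount-suc h m)) (shuffle (ascend upCount h m) R (downCount h m))
    where shuffle : ∀ a r d → a + r * d + d ≡ a + suc r * d
          shuffle = solve-∀

  -- [xᵐ] (R + 1) R^(h+j) x^(j+1) S^(h+2j+2): the peaks at level ℓ + 1 in continuations from
  -- height h after a down-step whose lowest level before the peak is ℓ − j.
  peakTerm : ℕ → ℕ → ℕ → ℕ
  peakTerm j h m = suc R * R ^ (h + j) * coeffˣ (suc j) (suc (suc (h + (j + j)))) m

  peakTerm′ : ℕ → ℕ → ℕ → ℕ
  peakTerm′ j h m = suc R * R ^ (h + j) * coeffˣ (suc j) (suc (h + (j + j))) (suc m)

  peakTerm-suc : ∀ j h m → peakTerm j h (suc m) ≡ peakTerm′ j h m + peakTerm j h m + peakTerm j (suc h) m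
  peakTerm-suc j h m = trans (cong (suc R * R ^ (h + j) *_) (coeffˣ-rec (suc j) (suc (h + (j + j))) m))
    (shuffle (suc R) (R ^ (h + j)) R _ _ _)
    where shuffle : ∀ s p r x y z → s * p * (x + y + r * z) ≡ s * p * x + s * p * y + s * (r * p) * z
          shuffle = solve-∀

  peakTerm′-suc-h : ∀ j h m → peakTerm′ j (suc h) m ≡ R * peakTerm j h (suc m)
  peakTerm′-suc-h j h m = shuffle (suc R) (R ^ (h + j)) R (coeffˣ (suc j) (suc (suc (h + (j + j)))) (suc m))
    where shuffle : ∀ s p r x → s * (r * p) * x ≡ r * (s * p * x)
          shuffle = solve-∀

  peakTerm′-suc-j : ∀ j h m → peakTerm′ (suc j) h m ≡ peakTerm j (suc h) m
  peakTerm′-suc-j j h m = cong₂ (λ e a → suc R * R ^ e * coeffˣ (suc j) a m) (+-suc h j) (reassoc h j)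
    where reassoc : ∀ h j → suc (h + (suc j + suc j)) ≡ suc (suc (suc h + (j + j)))
          reassoc = solve-∀

  peakTerm′-zero : ∀ h m → peakTerm′ 0 h m ≡ suc R * downCount h m
  peakTerm′-zero h m = trans (cong (λ e → suc R * R ^ e * coeff (suc e) m) (+-identityʳ h)) (*-assoc (suc R) (R ^ h) _)

  downPeaks : ℕ → ℕ → ℕ
  downPeaks h m = ∑[ j < suc ℓ ] (𝟙 (ℓ ≤ᵇ h + j) * peakTerm j h m)

  upPeaks : ℕ → ℕ → ℕ
  upPeaks h m = downPeaks (suc h) m + downPeaks h m + 𝟙 (h ≡ᵇ ℓ) * (suc R * downCount h m)

  downPeaks-zero : ∀ h → downPeaks h 0 ≡ 0
  downPeaks-zero h = ∑<-zero (suc ℓ) (λ j _ →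
    trans (cong (𝟙 (ℓ ≤ᵇ h + j) *_) (*-zeroʳ (suc R * R ^ (h + j)))) (*-zeroʳ (𝟙 (ℓ ≤ᵇ h + j))))

  ∑-≤ᵇ-split : ∀ (x f : ℕ → ℕ) → ∑[ j < suc ℓ ] (𝟙 (ℓ ≤ᵇ x j) * f j)
             ≡ ∑[ j < suc ℓ ] (𝟙 (x j ≡ᵇ ℓ) * f j) + ∑[ j < suc ℓ ] (𝟙 (suc ℓ ≤ᵇ x j) * f j)
  ∑-≤ᵇ-split x f = trans (∑<-cong (suc ℓ) (λ j _ → trans (cong (_* f j) (𝟙-≤ᵇ-split ℓ (x j)))
                                                         (*-distribʳ-+ (f j) (𝟙 (x j ≡ᵇ ℓ)) _)))
                         (∑<-+ (suc ℓ) (λ j → 𝟙 (x j ≡ᵇ ℓ) * f j) (λ j → 𝟙 (suc ℓ ≤ᵇ x j) * f j))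

  below : ℕ → ℕ → ℕ
  below zero    m = 0
  below (suc h) m = R * downPeaks h (suc m)

  boundary : ℕ → ℕ → ℕ
  boundary h m = ∑[ j < suc ℓ ] (𝟙 (suc h + j ≡ᵇ ℓ) * peakTerm j (suc h) m)

  interior : ℕ → ℕ → ℕ
  interior h m = ∑[ j < suc ℓ ] (𝟙 (ℓ ≤ᵇ h + j) * peakTerm j (suc h) m)

  downPeaks-split : ∀ h m → downPeaks (suc h) m ≡ boundary h m + interior h m
  downPeaks-split h m = trans (∑-≤ᵇ-split (λ j → suc h + j) (λ j → peakTerm j (suc h) m))
    (cong (boundary h m +_)
          (∑<-cong (suc ℓ) (λ j _ → cong (λ b → 𝟙 b * peakTerm j (suc h) m) (<ᵇ-suc ℓ (h + j)))))

  ∑-peakTerm′ : ∀ h m → ∑[ j < suc ℓ ] (𝟙 (ℓ ≤ᵇ h + j) * peakTerm′ j h m)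
              ≡ 𝟙 (h ≡ᵇ ℓ) * (suc R * downCount h m) + boundary h m + below h m
  ∑-peakTerm′ h m = trans (∑-≤ᵇ-split (λ j → h + j) (λ j → peakTerm′ j h m)) (cong₂ _+_ level (deeper h))
    where
    E : ℕ → ℕ
    E j = 𝟙 (suc h + j ≡ᵇ ℓ) * peakTerm j (suc h) m
    level : ∑[ j < suc ℓ ] (𝟙 (h + j ≡ᵇ ℓ) * peakTerm′ j h m)
          ≡ 𝟙 (h ≡ᵇ ℓ) * (suc R * downCount h m) + boundary h m
    level = cong₂ _+_
      (cong₂ _*_ (cong (λ x → 𝟙 (x ≡ᵇ ℓ)) (+-identityʳ h)) (peakTerm′-zero h m))
      (begin
        ∑[ j < ℓ ] (𝟙 (h + suc j ≡ᵇ ℓ) * peakTerm′ (suc j) h m)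
          ≡⟨ ∑<-cong ℓ (λ j _ → cong₂ _*_ (cong (λ x → 𝟙 (x ≡ᵇ ℓ)) (+-suc h j)) (peakTerm′-suc-j j h m)) ⟩
        ∑< ℓ E
          ≡⟨ +-identityʳ _ ⟨
        ∑< ℓ E + 0
          ≡⟨ cong (λ b → ∑< ℓ E + 𝟙 b * peakTerm ℓ (suc h) m) (≡ᵇ-< (s≤s (m≤n+m ℓ h))) ⟨
        ∑< ℓ E + E ℓ
          ≡⟨ ∑<-last ℓ E ⟨
        boundary h m ∎)
    deeper : ∀ h → ∑[ j < suc ℓ ] (𝟙 (suc ℓ ≤ᵇ h + j) * peakTerm′ j h m) ≡ below h m
    deeper zero    = ∑<-zero (suc ℓ) (λ j j<1+ℓ → cong (λ b → 𝟙 b * peakTerm′ j 0 m) (≤ᵇ-< j<1+ℓ))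
    deeper (suc h) = begin
      ∑[ j < suc ℓ ] (𝟙 (suc ℓ ≤ᵇ suc h + j) * peakTerm′ j (suc h) m)
        ≡⟨ ∑<-cong (suc ℓ) (λ j _ → cong₂ _*_ (cong 𝟙 (<ᵇ-suc ℓ (h + j))) (peakTerm′-suc-h j h m)) ⟩
      ∑[ j < suc ℓ ] (𝟙 (ℓ ≤ᵇ h + j) * (R * peakTerm j h (suc m)))
        ≡⟨ ∑<-cong (suc ℓ) (λ j _ → x∙yz≈y∙xz (𝟙 (ℓ ≤ᵇ h + j)) R (peakTerm j h (suc m))) ⟩
      ∑[ j < suc ℓ ] (R * (𝟙 (ℓ ≤ᵇ h + j) * peakTerm j h (suc m)))
        ≡⟨ ∑<-*ˡ (suc ℓ) R (λ j → 𝟙 (ℓ ≤ᵇ h + j) * peakTerm j h (suc m)) ⟩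
      R * downPeaks h (suc m) ∎
      where x∙yz≈y∙xz : ∀ x y z → x * (y * z) ≡ y * (x * z)
            x∙yz≈y∙xz = solve-∀

  downPeaks-suc-m : ∀ h m → downPeaks h (suc m) ≡ upPeaks h m + below h m
  downPeaks-suc-m h m = begin
    ∑[ j < suc ℓ ] (θ j * peakTerm j h (suc m))
      ≡⟨ ∑<-cong (suc ℓ) (λ j _ → trans (cong (θ j *_) (peakTerm-suc j h m))
                                         (distrib (θ j) (peakTerm′ j h m) (peakTerm j h m) (peakTerm j (suc h) m))) ⟩
    ∑[ j < suc ℓ ] (θ j * peakTerm′ j h m + θ j * peakTerm j h m + θ j * peakTerm j (suc h) m)
      ≡⟨ ∑<-+ (suc ℓ) (λ j → θ j * peakTerm′ j h m + θ j * peakTerm j h m)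
                      (λ j → θ j * peakTerm j (suc h) m) ⟩
    ∑[ j < suc ℓ ] (θ j * peakTerm′ j h m + θ j * peakTerm j h m) + interior h m
      ≡⟨ cong (_+ interior h m) (∑<-+ (suc ℓ) (λ j → θ j * peakTerm′ j h m)
                                              (λ j → θ j * peakTerm j h m)) ⟩
    ∑[ j < suc ℓ ] (θ j * peakTerm′ j h m) + downPeaks h m + interior h m
      ≡⟨ cong (λ x → x + downPeaks h m + interior h m) (∑-peakTerm′ h m) ⟩
    𝟙 (h ≡ᵇ ℓ) * (suc R * downCount h m) + boundary h m + below h m + downPeaks h m + interior h m
      ≡⟨ regroup (𝟙 (h ≡ᵇ ℓ) * (suc R * downCount h m)) (boundary h m) (below h m)
                 (downPeaks h m) (interior h m) ⟩
    boundary h m + interior h m + downPeaks h m + 𝟙 (h ≡ᵇ ℓ) * (suc R * downCount h m) + below h m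
      ≡⟨ cong (λ x → x + downPeaks h m + 𝟙 (h ≡ᵇ ℓ) * (suc R * downCount h m) + below h m)
              (downPeaks-split h m) ⟨
    upPeaks h m + below h m ∎
    where
    θ : ℕ → ℕ
    θ j = 𝟙 (ℓ ≤ᵇ h + j)
    distrib : ∀ t x y z → t * (x + y + z) ≡ t * x + t * y + t * z
    distrib = solve-∀
    regroup : ∀ i e b d c → i + e + b + d + c ≡ e + c + d + i + b
    regroup = solve-∀

  downPeaks-zero-suc : ∀ m → downPeaks 0 (suc m) ≡ upPeaks 0 m
  downPeaks-zero-suc m = trans (downPeaks-suc-m 0 m) (+-identityʳ _)

  downPeaks-suc : ∀ h m → downPeaks (suc h) m ≡ ascend upPeaks h m + R * downPeaks h m
  downPeaks-suc h zero    = trans (downPeaks-zero (suc h)) (sym (trans (cong (R *_) (downPeaks-zero h)) (*-zeroʳ R)))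
  downPeaks-suc h (suc m) = downPeaks-suc-m (suc h) m

  upPeaks-rec : ∀ h m →
    upPeaks h m ≡ ascend upPeaks h m + suc R * (𝟙 (h ≡ᵇ ℓ) * downCount h m + downPeaks h m)
  upPeaks-rec h m =
    trans (cong (λ x → x + downPeaks h m + 𝟙 (h ≡ᵇ ℓ) * (suc R * downCount h m)) (downPeaks-suc h m))
    (shuffle (ascend upPeaks h m) R (downPeaks h m) (𝟙 (h ≡ᵇ ℓ)) (downCount h m))
    where shuffle : ∀ a r d i c → a + r * d + d + i * (suc r * c) ≡ a + suc r * (i * c + d)
          shuffle = solve-∀

  downPeaks-zero-riordan : ∀ n → downPeaks 0 (suc n) ≡ riordanEntry ℓ n
  downPeaks-zero-riordan n = begin
    downPeaks 0 (suc n)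
      ≡⟨ ∑<-last ℓ (λ j → 𝟙 (ℓ ≤ᵇ j) * peakTerm j 0 (suc n)) ⟩
    ∑[ j < ℓ ] (𝟙 (ℓ ≤ᵇ j) * peakTerm j 0 (suc n)) + 𝟙 (ℓ ≤ᵇ ℓ) * peakTerm ℓ 0 (suc n)
      ≡⟨ cong₂ _+_ (∑<-zero ℓ (λ j j<ℓ → cong (λ b → 𝟙 b * peakTerm j 0 (suc n)) (≤ᵇ-< j<ℓ)))
                   (cong (λ b → 𝟙 b * peakTerm ℓ 0 (suc n)) (≤ᵇ-refl ℓ)) ⟩
    1 * riordanEntry ℓ n
      ≡⟨ *-identityˡ _ ⟩
    riordanEntry ℓ n ∎

module Paths (R : ℕ) where

  Word : Set
  Word = List (Step (suc R))

  ∑words : ℕ → (Word → ℕ) → ℕ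
  ∑words k f = sum (map f (words (suc R) k))

  ∑colors : (Fin (suc R) → ℕ) → ℕ
  ∑colors g = sum (map g (allFin (suc R)))

  ∑words-cong : ∀ k {f g : Word → ℕ} → (∀ w → f w ≡ g w) → ∑words k f ≡ ∑words k g
  ∑words-cong k f≗g = cong sum (List.map-cong f≗g (words (suc R) k))

  ∑colors-cong : ∀ {f g : Fin (suc R) → ℕ} → (∀ c → f c ≡ g c) → ∑colors f ≡ ∑colors g
  ∑colors-cong f≗g = cong sum (List.map-cong f≗g (allFin (suc R)))

  ∑colors-const : ∀ x → ∑colors (λ _ → x) ≡ suc R * x
  ∑colors-const x =
    trans (cong sum (List.map-tabulate {n = suc R} (λ c → c) (λ _ → x))) (sum-tabulate-const (suc R) x)

  ∑colors-distinct : ∀ c x → ∑colors (λ c′ → distinct c c′ * x) ≡ R * x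
  ∑colors-distinct c x =
    trans (cong sum (List.map-tabulate (λ c → c) (λ c′ → distinct c c′ * x))) (sum-tabulate-distinct R c x)

  ∑words-suc : ∀ k (f : Word → ℕ) →
    ∑words (suc k) f ≡ ∑words k (λ w → f (U ∷ w)) + ∑colors (λ c → ∑words k (λ w → f (D c ∷ w)))
  ∑words-suc k f = begin
    sum (map f (concatMap (λ w → map (_∷ w) (steps (suc R))) (words (suc R) k)))
      ≡⟨ sum-map-concatMap (words (suc R) k) (λ w → map (_∷ w) (steps (suc R))) f ⟩
    sum (map (λ w → f (U ∷ w) + sum (map f (map (_∷ w) (map D (allFin (suc R)))))) (words (suc R) k))
      ≡⟨ ∑words-cong k (λ w → cong (λ xs → f (U ∷ w) + sum xs)
                         (trans (sym (List.map-∘ (map D (allFin (suc R))))) (sym (List.map-∘ (allFin (suc R)))))) ⟩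
    sum (map (λ w → f (U ∷ w) + ∑colors (λ c → f (D c ∷ w))) (words (suc R) k))
      ≡⟨ sum-map-+ (words (suc R) k) (λ w → f (U ∷ w)) (λ w → ∑colors (λ c → f (D c ∷ w))) ⟩
    ∑words k (λ w → f (U ∷ w)) + sum (map (λ w → ∑colors (λ c → f (D c ∷ w))) (words (suc R) k))
      ≡⟨ cong (∑words k (λ w → f (U ∷ w)) +_)
              (sum-map-swap (words (suc R) k) (allFin (suc R)) (λ w c → f (D c ∷ w))) ⟩
    ∑words k (λ w → f (U ∷ w)) + ∑colors (λ c → ∑words k (λ w → f (D c ∷ w))) ∎

  ∑words-unreachable : ∀ k h (X : Word → Bool) (f : Word → ℕ) → k < h →
                       ∑words k (λ w → 𝟙 (dyckFrom h w ∧ X w) * f w) ≡ 0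
  ∑words-unreachable zero    (suc h) X f _          = refl
  ∑words-unreachable (suc k) (suc h) X f (s<s k<h) = trans (∑words-suc k _) (cong₂ _+_
    (∑words-unreachable k (suc (suc h)) (X ∘ (U ∷_)) (f ∘ (U ∷_)) (m<n⇒m<1+n (m<n⇒m<1+n k<h)))
    (sum-map-zero (allFin (suc R)) (λ c → ∑words-unreachable k h (X ∘ (D c ∷_)) (f ∘ (D c ∷_)) k<h)))

  valid : ℕ → Word → Bool
  valid h w = dyckFrom h w ∧ noSameDD w

  -- The first step s is kept apart so that a recursion on k sees which colour it forbids
  -- next and whether it closes a peak.
  total : (ℕ → Word → ℕ) → ℕ → Step (suc R) → ℕ → ℕ
  total F h s k = ∑words k (λ w → 𝟙 (valid h (s ∷ w)) * F h (s ∷ w))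

  total-D-zero : ∀ F c k → total F 0 (D c) k ≡ 0
  total-D-zero F c k = sum-map-zero (words (suc R) k) (λ _ → refl)

  total-U-short : ∀ F h k → k < suc h → total F h U k ≡ 0
  total-U-short F h k = ∑words-unreachable k (suc h) noSameDD (λ w → F h (U ∷ w))

  total-D-suc : ∀ F → (∀ h c w → F (suc h) (D c ∷ w) ≡ F h w) → ∀ h c k →
    total F (suc h) (D c) (suc k) ≡ total F h U k + ∑colors (λ c′ → distinct c c′ * total F h (D c′) k)
  total-D-suc F F-D h c k = trans (∑words-suc k _) (cong₂ _+_
    (∑words-cong k (λ w → cong (𝟙 (valid h (U ∷ w)) *_) (F-D h c (U ∷ w))))
    (∑colors-cong (λ c′ → trans (∑words-cong k (λ w → D-D c′ w))
                                (sum-map-*ˡ (words (suc R) k) (distinct c c′)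
                                            (λ w → 𝟙 (valid h (D c′ ∷ w)) * F h (D c′ ∷ w))))))
    where
    D-D : ∀ c′ w → 𝟙 (valid (suc h) (D c ∷ D c′ ∷ w)) * F (suc h) (D c ∷ D c′ ∷ w)
                 ≡ distinct c c′ * (𝟙 (valid h (D c′ ∷ w)) * F h (D c′ ∷ w))
    D-D c′ w = begin
      𝟙 (valid (suc h) (D c ∷ D c′ ∷ w)) * F (suc h) (D c ∷ D c′ ∷ w)
        ≡⟨ cong₂ _*_ (𝟙-∧-∧ (dyckFrom h (D c′ ∷ w)) (not ⌊ c ≟ᶠ c′ ⌋) (noSameDD (D c′ ∷ w)))
                     (F-D h c (D c′ ∷ w)) ⟩
      distinct c c′ * 𝟙 (valid h (D c′ ∷ w)) * F h (D c′ ∷ w)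
        ≡⟨ *-assoc (distinct c c′) _ _ ⟩
      distinct c c′ * (𝟙 (valid h (D c′ ∷ w)) * F h (D c′ ∷ w)) ∎

  total-D-one : ∀ F → (∀ h c w → F (suc h) (D c ∷ w) ≡ F h w) → ∀ c k →
                total F 1 (D c) (suc k) ≡ total F 0 U k
  total-D-one F F-D c k = trans (total-D-suc F F-D 0 c k) (trans (cong (total F 0 U k +_) no-D)
                                                                  (+-identityʳ _))
    where
    no-D : ∑colors (λ c′ → distinct c c′ * total F 0 (D c′) k) ≡ 0
    no-D = sum-map-zero (allFin (suc R)) (λ c′ → trans (cong (distinct c c′ *_) (total-D-zero F c′ k))
                                                       (*-zeroʳ (distinct c c′)))

  total-U-suc : ∀ F → (∀ h w → F h (U ∷ U ∷ w) ≡ F (suc h) (U ∷ w)) → ∀ h k →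
    total F h U (suc k) ≡
    total F (suc h) U k + ∑colors (λ c → ∑words k (λ w → 𝟙 (valid (suc h) (D c ∷ w)) * F h (U ∷ D c ∷ w)))
  total-U-suc F F-U h k = trans (∑words-suc k _)
    (cong (_+ ∑colors (λ c → ∑words k (λ w → 𝟙 (valid (suc h) (D c ∷ w)) * F h (U ∷ D c ∷ w))))
          (∑words-cong k (λ w → cong (𝟙 (valid (suc h) (U ∷ w)) *_) (F-U h w))))

module PeakCounting (R ℓ : ℕ) where
  open Coefficients R
  open Paths R
  open ClosedForms R ℓ

  count : ℕ → Step (suc R) → ℕ → ℕ
  count = total (λ _ _ → 1)

  peaks : ℕ → Step (suc R) → ℕ → ℕ
  peaks = total (peaksAt (suc ℓ))

  total-U-ascend : ∀ F u k h m → (∀ h m → k ≡ suc (h + (m + m)) → total F h U k ≡ u h m) →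
                   k ≡ h + (m + m) → total F (suc h) U k ≡ ascend u h m
  total-U-ascend F u k h zero    _  eq = total-U-short F (suc h) k
    (subst (_< 2 + h) (sym eq) (s≤s (m≤n⇒m≤1+n (≤-reflexive (+-identityʳ h)))))
  total-U-ascend F u k h (suc m) IH eq = IH (suc h) m (trans eq (shuffle h m))
    where shuffle : ∀ h m → h + (suc m + suc m) ≡ suc (suc h + (m + m))
          shuffle = solve-∀

  mutual
    count-D : ∀ k h m c → k ≡ h + (m + m) → count (suc h) (D c) k ≡ downCount h m
    count-D zero    zero    zero    c _  = refl
    count-D (suc k) zero    (suc m) c eq = begin
      count 1 (D c) (suc k) ≡⟨ total-D-one (λ _ _ → 1) (λ _ _ _ → refl) c k ⟩
      count 0 U k           ≡⟨ count-U k 0 m (trans (suc-injective eq) (+-suc m m)) ⟩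
      upCount 0 m           ≡⟨ downCount-zero-suc m ⟨
      downCount 0 (suc m)   ∎
    count-D (suc k) (suc h) m c eq = begin
      count (suc (suc h)) (D c) (suc k)
        ≡⟨ total-D-suc (λ _ _ → 1) (λ _ _ _ → refl) (suc h) c k ⟩
      count (suc h) U k + ∑colors (λ c′ → distinct c c′ * count (suc h) (D c′) k)
        ≡⟨ cong₂ _+_ (total-U-ascend (λ _ _ → 1) upCount k h m (count-U k) (suc-injective eq))
                     (trans (∑colors-cong (λ c′ → cong (distinct c c′ *_) (count-D k h m c′ (suc-injective eq))))
                            (∑colors-distinct c (downCount h m))) ⟩
      ascend upCount h m + R * downCount h m
        ≡⟨ downCount-suc h m ⟨
      downCount (suc h) m ∎

    count-U : ∀ k h m → k ≡ suc (h + (m + m)) → count h U k ≡ upCount h m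
    count-U (suc k) h m eq = begin
      count h U (suc k)
        ≡⟨ total-U-suc (λ _ _ → 1) (λ _ _ → refl) h k ⟩
      count (suc h) U k + ∑colors (λ c → count (suc h) (D c) k)
        ≡⟨ cong₂ _+_ (total-U-ascend (λ _ _ → 1) upCount k h m (count-U k) (suc-injective eq))
                     (trans (∑colors-cong (λ c → count-D k h m c (suc-injective eq)))
                            (∑colors-const (downCount h m))) ⟩
      ascend upCount h m + suc R * downCount h m
        ≡⟨ upCount-rec h m ⟨
      upCount h m ∎

  peak-closed-by-D : ∀ h c k →
    ∑words k (λ w → 𝟙 (valid (suc h) (D c ∷ w)) * peaksAt (suc ℓ) h (U ∷ D c ∷ w))
    ≡ 𝟙 (h ≡ᵇ ℓ) * count (suc h) (D c) k + peaks (suc h) (D c) k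
  peak-closed-by-D h c k = begin
    ∑words k (λ w → v w * (𝟙 (h ≡ᵇ ℓ) + q w))
      ≡⟨ ∑words-cong k (λ w → distrib (v w) (𝟙 (h ≡ᵇ ℓ)) (q w)) ⟩
    ∑words k (λ w → 𝟙 (h ≡ᵇ ℓ) * (v w * 1) + v w * q w)
      ≡⟨ sum-map-+ (words (suc R) k) (λ w → 𝟙 (h ≡ᵇ ℓ) * (v w * 1)) (λ w → v w * q w) ⟩
    ∑words k (λ w → 𝟙 (h ≡ᵇ ℓ) * (v w * 1)) + peaks (suc h) (D c) k
      ≡⟨ cong (_+ peaks (suc h) (D c) k) (sum-map-*ˡ (words (suc R) k) (𝟙 (h ≡ᵇ ℓ)) (λ w → v w * 1)) ⟩
    𝟙 (h ≡ᵇ ℓ) * count (suc h) (D c) k + peaks (suc h) (D c) k ∎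
    where
    v q : Word → ℕ
    v w = 𝟙 (valid (suc h) (D c ∷ w))
    q w = peaksAt (suc ℓ) (suc h) (D c ∷ w)
    distrib : ∀ v i q → v * (i + q) ≡ i * (v * 1) + v * q
    distrib = solve-∀

  mutual
    peaks-D : ∀ k h m c → k ≡ h + (m + m) → peaks (suc h) (D c) k ≡ downPeaks h m
    peaks-D zero    zero    zero    c _  = sym (downPeaks-zero 0)
    peaks-D (suc k) zero    (suc m) c eq = begin
      peaks 1 (D c) (suc k) ≡⟨ total-D-one (peaksAt (suc ℓ)) (λ _ _ _ → refl) c k ⟩
      peaks 0 U k           ≡⟨ peaks-U k 0 m (trans (suc-injective eq) (+-suc m m)) ⟩
      upPeaks 0 m           ≡⟨ downPeaks-zero-suc m ⟨
      downPeaks 0 (suc m)   ∎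
    peaks-D (suc k) (suc h) m c eq = begin
      peaks (suc (suc h)) (D c) (suc k)
        ≡⟨ total-D-suc (peaksAt (suc ℓ)) (λ _ _ _ → refl) (suc h) c k ⟩
      peaks (suc h) U k + ∑colors (λ c′ → distinct c c′ * peaks (suc h) (D c′) k)
        ≡⟨ cong₂ _+_ (total-U-ascend (peaksAt (suc ℓ)) upPeaks k h m (peaks-U k) (suc-injective eq))
                     (trans (∑colors-cong (λ c′ → cong (distinct c c′ *_) (peaks-D k h m c′ (suc-injective eq))))
                            (∑colors-distinct c (downPeaks h m))) ⟩
      ascend upPeaks h m + R * downPeaks h m
        ≡⟨ downPeaks-suc h m ⟨
      downPeaks (suc h) m ∎

    peaks-U : ∀ k h m → k ≡ suc (h + (m + m)) → peaks h U k ≡ upPeaks h m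
    peaks-U (suc k) h m eq = begin
      peaks h U (suc k)
        ≡⟨ total-U-suc (peaksAt (suc ℓ)) (λ _ _ → refl) h k ⟩
      peaks (suc h) U k
      + ∑colors (λ c → ∑words k (λ w → 𝟙 (valid (suc h) (D c ∷ w)) * peaksAt (suc ℓ) h (U ∷ D c ∷ w)))
        ≡⟨ cong₂ _+_ (total-U-ascend (peaksAt (suc ℓ)) upPeaks k h m (peaks-U k) (suc-injective eq))
                     (trans (∑colors-cong (λ c → trans (peak-closed-by-D h c k) (after-D c)))
                            (∑colors-const (𝟙 (h ≡ᵇ ℓ) * downCount h m + downPeaks h m))) ⟩
      ascend upPeaks h m + suc R * (𝟙 (h ≡ᵇ ℓ) * downCount h m + downPeaks h m)
        ≡⟨ upPeaks-rec h m ⟨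
      upPeaks h m ∎
      where
      after-D : ∀ c → 𝟙 (h ≡ᵇ ℓ) * count (suc h) (D c) k + peaks (suc h) (D c) k
                    ≡ 𝟙 (h ≡ᵇ ℓ) * downCount h m + downPeaks h m
      after-D c = cong₂ (λ x y → 𝟙 (h ≡ᵇ ℓ) * x + y) (count-D k h m c (suc-injective eq))
                                                     (peaks-D k h m c (suc-injective eq))

  p-riordanEntry : ∀ n → p (suc R) n ℓ ≡ riordanEntry ℓ n
  p-riordanEntry n = begin
    sum (map (peaksAt (suc ℓ) 0) (filterᵇ inA (words (suc R) (2 * suc n))))
      ≡⟨ sum-map-filterᵇ inA (peaksAt (suc ℓ) 0) (words (suc R) (2 * suc n)) ⟩
    ∑words (suc k) (λ w → 𝟙 (inA w) * peaksAt (suc ℓ) 0 w)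
      ≡⟨ ∑words-suc k (λ w → 𝟙 (inA w) * peaksAt (suc ℓ) 0 w) ⟩
    peaks 0 U k + ∑colors (λ c → peaks 0 (D c) k)
      ≡⟨ cong₂ _+_ (peaks-U k 0 n (length n))
                   (sum-map-zero (allFin (suc R)) (λ c → total-D-zero (peaksAt (suc ℓ)) c k)) ⟩
    upPeaks 0 n + 0
      ≡⟨ +-identityʳ _ ⟩
    upPeaks 0 n
      ≡⟨ downPeaks-zero-suc n ⟨
    downPeaks 0 (suc n)
      ≡⟨ downPeaks-zero-riordan n ⟩
    riordanEntry ℓ n ∎
    where
    k : ℕ
    k = n + suc (n + 0)
    length : ∀ n → n + suc (n + 0) ≡ suc (0 + (n + n))
    length = solve-∀

open import Data.Integer using (+_)

sumℤ-+ : ∀ (ns : List ℕ) → sumℤ (map +_ ns) ≡ + sum ns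
sumℤ-+ []       = refl
sumℤ-+ (n ∷ ns) = trans (cong (ℤ._+_ (+ n)) (sumℤ-+ ns)) (sym (ℤ.pos-+ n (sum ns)))

⊛-+ : ∀ n {f g : Series} {f′ g′ : ℕ → ℕ} →
      (∀ i → i ≤ n → f i ≡ + f′ i) → (∀ i → i ≤ n → g i ≡ + g′ i) →
      (f ⊛ g) n ≡ + ∑[ i + j ≡ n ] (f′ i * g′ j)
⊛-+ n {f} {g} {f′} {g′} f≗ g≗ = begin
  sumℤ (map (λ i → f i ℤ.* g (n ∸ i)) (upTo (suc n)))
    ≡⟨ cong sumℤ (List.map-upTo (λ i → f i ℤ.* g (n ∸ i)) (suc n)) ⟩
  sumℤ (applyUpTo (λ i → f i ℤ.* g (n ∸ i)) (suc n))
    ≡⟨ cong sumℤ (applyUpTo-cong (suc n) termwise) ⟩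
  sumℤ (applyUpTo (+_ ∘ λ i → f′ i * g′ (n ∸ i)) (suc n))
    ≡⟨ cong sumℤ (List.map-applyUpTo (λ i → f′ i * g′ (n ∸ i)) +_ (suc n)) ⟨
  sumℤ (map +_ (applyUpTo (λ i → f′ i * g′ (n ∸ i)) (suc n)))
    ≡⟨ sumℤ-+ (applyUpTo (λ i → f′ i * g′ (n ∸ i)) (suc n)) ⟩
  + sum (applyUpTo (λ i → f′ i * g′ (n ∸ i)) (suc n))
    ≡⟨ cong +_ (∑⁺-applyUpTo n (λ i j → f′ i * g′ j)) ⟩
  + ∑[ i + j ≡ n ] (f′ i * g′ j) ∎
  where
  termwise : ∀ i → i < suc n → f i ℤ.* g (n ∸ i) ≡ + (f′ i * g′ (n ∸ i))
  termwise i i<1+n = trans (cong₂ ℤ._*_ (f≗ i (≤-pred i<1+n)) (g≗ (n ∸ i) (m∸n≤m n i)))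
                           (sym (ℤ.pos-* (f′ i) (g′ (n ∸ i))))

module Solution (R : ℕ) (S : Series) (S-eq : IsSr (suc R) S) where
  open Coefficients R

  S-coeff-≤ : ∀ n i → i ≤ n → S i ≡ + coeff 1 i
  S-coeff-≤ n       zero    _ = trans (S-eq 0) (cong (λ t → + 1 ℤ.+ (+ 0 ℤ.+ t)) (ℤ.*-zeroʳ (+ R)))
  S-coeff-≤ (suc n) (suc i) (s≤s i≤n) = begin
    S (suc i)                                    ≡⟨ S-eq (suc i) ⟩
    + 0 ℤ.+ (S i ℤ.+ + R ℤ.* (S ⊛ S) i)          ≡⟨ ℤ.+-identityˡ _ ⟩
    S i ℤ.+ + R ℤ.* (S ⊛ S) i                    ≡⟨ cong₂ (λ s t → s ℤ.+ + R ℤ.* t) (S-coeff-≤ n i i≤n) square ⟩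
    + coeff 1 i ℤ.+ + R ℤ.* + coeff 2 i          ≡⟨ cong (ℤ._+_ (+ coeff 1 i)) (ℤ.pos-* R (coeff 2 i)) ⟨
    + (coeff 1 (suc i))                          ∎
    where
    earlier : ∀ j → j ≤ i → S j ≡ + coeff 1 j
    earlier j j≤i = S-coeff-≤ n j (≤-trans j≤i i≤n)
    square : (S ⊛ S) i ≡ + coeff 2 i
    square = trans (⊛-+ i earlier earlier) (cong +_ (coeff-convolution i 1 1))

  S-coeff : ∀ i → S i ≡ + coeff 1 i
  S-coeff i = S-coeff-≤ i i ≤-refl

  S²-coeff : ∀ i → (S ⊛ S) i ≡ + coeff 2 i
  S²-coeff i = trans (⊛-+ i (λ j _ → S-coeff j) (λ j _ → S-coeff j)) (cong +_ (coeff-convolution i 1 1))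

  h : Series
  h = xS (scaleS (+ R) (S ⊛ S))

  private
    hₙ : ℕ → ℕ
    hₙ zero    = 0
    hₙ (suc i) = R * coeff 2 i

    h-coeff : ∀ i → h i ≡ + hₙ i
    h-coeff zero    = refl
    h-coeff (suc i) = trans (cong (ℤ._*_ (+ R)) (S²-coeff i)) (sym (ℤ.pos-* R (coeff 2 i)))

  powS-h : ∀ ℓ m → powS h ℓ m ≡ + (R ^ ℓ * coeffˣ ℓ (ℓ + ℓ) m)
  powS-h zero    zero    = refl
  powS-h zero    (suc m) = refl
  powS-h (suc ℓ) m       = trans (⊛-+ m (λ i _ → h-coeff i) (λ j _ → powS-h ℓ j)) (cong +_ (shifted m))
    where
    shifted : ∀ m → ∑[ i + j ≡ m ] (hₙ i * (R ^ ℓ * coeffˣ ℓ (ℓ + ℓ) j))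
                    ≡ R ^ suc ℓ * coeffˣ (suc ℓ) (suc ℓ + suc ℓ) m
    shifted zero    = sym (*-zeroʳ (R ^ suc ℓ))
    shifted (suc m) = begin
      ∑[ i + j ≡ m ] (R * coeff 2 i * (R ^ ℓ * coeffˣ ℓ (ℓ + ℓ) j))
        ≡⟨ scaled-convolution R (R ^ ℓ) ℓ (ℓ + ℓ) m ⟩
      R ^ suc ℓ * coeffˣ ℓ (suc (suc (ℓ + ℓ))) m
        ≡⟨ cong (λ b → R ^ suc ℓ * coeffˣ ℓ (suc b) m) (sym (+-suc ℓ ℓ)) ⟩
      R ^ suc ℓ * coeffˣ ℓ (suc ℓ + suc ℓ) m ∎

  riordan-S : ∀ n ℓ → riordan (scaleS (+ suc R) (S ⊛ S)) h n ℓ ≡ + riordanEntry ℓ n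
  riordan-S n ℓ = trans (⊛-+ n (λ i _ → d-coeff i) (λ j _ → powS-h ℓ j))
                        (cong +_ (scaled-convolution (suc R) (R ^ ℓ) ℓ (ℓ + ℓ) n))
    where
    d-coeff : ∀ i → scaleS (+ suc R) (S ⊛ S) i ≡ + (suc R * coeff 2 i)
    d-coeff i = trans (cong (ℤ._*_ (+ suc R)) (S²-coeff i)) (sym (ℤ.pos-* (suc R) (coeff 2 i)))

open import Data.Rational using (ℚ; _/_)

private
  toℚᵘ-/ : ∀ n d → ℚ.toℚᵘ (n / suc d) ℚᵘ.≃ ℚᵘ.mkℚᵘ n d
  toℚᵘ-/ n d = ℚ.toℚᵘ-fromℚᵘ (ℚᵘ.mkℚᵘ n d)

/1-+ : ∀ a b → (+ a / 1) ℚ.+ (+ b / 1) ≡ + (a + b) / 1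
/1-+ a b = ℚ.toℚᵘ-injective (ℚᵘ.≃-trans (ℚ.toℚᵘ-homo-+ (+ a / 1) (+ b / 1))
  (ℚᵘ.≃-trans (ℚᵘ.+-cong (toℚᵘ-/ (+ a) 0) (toℚᵘ-/ (+ b) 0))
  (ℚᵘ.≃-trans (ℚᵘ.*≡* cross) (ℚᵘ.≃-sym (toℚᵘ-/ (+ (a + b)) 0)))))
  where
  cross : (+ a ℤ.* + 1 ℤ.+ + b ℤ.* + 1) ℤ.* + 1 ≡ + (a + b) ℤ.* + 1
  cross = begin
    (+ a ℤ.* + 1 ℤ.+ + b ℤ.* + 1) ℤ.* + 1 ≡⟨ ℤ.*-identityʳ _ ⟩
    + a ℤ.* + 1 ℤ.+ + b ℤ.* + 1           ≡⟨ cong₂ ℤ._+_ (ℤ.*-identityʳ (+ a)) (ℤ.*-identityʳ (+ b)) ⟩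
    + a ℤ.+ + b                           ≡⟨ ℤ.pos-+ a b ⟨
    + (a + b)                             ≡⟨ ℤ.*-identityʳ _ ⟨
    + (a + b) ℤ.* + 1                     ∎

/-*-/1 : ∀ x d y z → suc d * z ≡ x * y → (+ x / suc d) ℚ.* (+ y / 1) ≡ + z / 1
/-*-/1 x d y z eq = ℚ.toℚᵘ-injective (ℚᵘ.≃-trans (ℚ.toℚᵘ-homo-* (+ x / suc d) (+ y / 1))
  (ℚᵘ.≃-trans (ℚᵘ.*-cong (toℚᵘ-/ (+ x) d) (toℚᵘ-/ (+ y) 0))
  (ℚᵘ.≃-trans (ℚᵘ.*≡* cross) (ℚᵘ.≃-sym (toℚᵘ-/ (+ z) 0)))))
  where
  cross : (+ x ℤ.* + y) ℤ.* + 1 ≡ + z ℤ.* + suc (d * 1)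
  cross = begin
    (+ x ℤ.* + y) ℤ.* + 1    ≡⟨ ℤ.*-identityʳ _ ⟩
    + x ℤ.* + y              ≡⟨ ℤ.pos-* x y ⟨
    + (x * y)                ≡⟨ cong +_ (trans (sym eq) (*-comm (suc d) z)) ⟩
    + (z * suc d)            ≡⟨ cong (λ t → + (z * suc t)) (sym (*-identityʳ d)) ⟩
    + (z * suc (d * 1))      ≡⟨ ℤ.pos-* z _ ⟩
    + z ℤ.* + suc (d * 1)    ∎

sumℚ-/1 : ∀ (ns : List ℕ) → sumℚ (map (λ n → + n / 1) ns) ≡ + sum ns / 1
sumℚ-/1 []       = refl
sumℚ-/1 (n ∷ ns) = trans (cong (ℚ._+_ (+ n / 1)) (sumℚ-/1 ns)) (/1-+ n (sum ns))

module ExplicitFormula (R : ℕ) where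
  open Coefficients R

  private
    a : ℕ → ℕ
    a ℓ = suc (suc (ℓ + ℓ))

    T : ℕ → ℕ → ℕ → ℕ
    T ℓ j k = suc R * R ^ ℓ * (forests (a ℓ) j k * R ^ k)

    double : ∀ ℓ j k → 2 * (ℓ + (j + k)) ∸ j ≡ ℓ + ℓ + j + (k + k)
    double ℓ j k = trans (cong (_∸ j) (expand ℓ j k)) (m+n∸n≡m (ℓ + ℓ + j + (k + k)) j)
      where expand : ∀ ℓ j k → 2 * (ℓ + (j + k)) ≡ ℓ + ℓ + j + (k + k) + j
            expand = solve-∀

    drop : ∀ ℓ j k → ℓ + (j + k) ∸ j ≡ ℓ + k
    drop ℓ j k = trans (cong (_∸ j) (reassoc ℓ j k)) (m+n∸n≡m (ℓ + k) j)
      where reassoc : ∀ ℓ j k → ℓ + (j + k) ≡ ℓ + k + j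
            reassoc = solve-∀

  term-closed : ∀ ℓ j k → term (suc R) (ℓ + (j + k)) ℓ j ≡ + T ℓ j k / 1
  term-closed ℓ j k = begin
    shape (2 * (ℓ + (j + k)) ∸ j) (ℓ + (j + k) ∸ ℓ) (ℓ + (j + k) ∸ j)
      ≡⟨ cong (λ d → shape d (ℓ + (j + k) ∸ ℓ) (ℓ + (j + k) ∸ j)) (double ℓ j k) ⟩
    shape N (ℓ + (j + k) ∸ ℓ) (ℓ + (j + k) ∸ j)
      ≡⟨ cong₂ (shape N) (m+n∸m≡n ℓ (j + k)) (drop ℓ j k) ⟩
    shape N (j + k) (ℓ + k)
      ≡⟨ /-*-/1 (2 * suc R * suc ℓ) (suc N) (B * R ^ (ℓ + k)) (T ℓ j k) cleared ⟩
    + T ℓ j k / 1 ∎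
    where
    -- term with its three truncated differences 2n − j, n − ℓ and n − j abstracted
    shape : ℕ → ℕ → ℕ → ℚ
    shape d s e = (+ (2 * suc R * suc ℓ) / suc (suc d)) ℚ.* (+ ((suc (suc d) C s) * (s C j) * R ^ e) / 1)
    N B : ℕ
    N = ℓ + ℓ + j + (k + k)
    B = (suc (suc N) C (j + k)) * ((j + k) C j)
    reorder : ∀ n c f q → n * (c * (f * q)) ≡ c * q * (n * f)
    reorder = solve-∀
    collect : ∀ r ℓ p q t → r * p * q * (suc (suc (ℓ + ℓ)) * t) ≡ 2 * r * suc ℓ * (t * (p * q))
    collect = solve-∀
    cleared : suc (suc N) * T ℓ j k ≡ 2 * suc R * suc ℓ * (B * R ^ (ℓ + k))
    cleared = begin
      suc (suc N) * (suc R * R ^ ℓ * (forests (a ℓ) j k * R ^ k))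
        ≡⟨ reorder (suc (suc N)) (suc R * R ^ ℓ) (forests (a ℓ) j k) (R ^ k) ⟩
      suc R * R ^ ℓ * R ^ k * (suc (suc N) * forests (a ℓ) j k)
        ≡⟨ cong (suc R * R ^ ℓ * R ^ k *_) (forests-closed (a ℓ) j k) ⟩
      suc R * R ^ ℓ * R ^ k * (a ℓ * trinomial (a ℓ + k) j k)
        ≡⟨ cong (λ n → suc R * R ^ ℓ * R ^ k * (a ℓ * ((n C (j + k)) * ((j + k) C j)))) (size (a ℓ) j k) ⟨
      suc R * R ^ ℓ * R ^ k * (a ℓ * B)
        ≡⟨ collect (suc R) ℓ (R ^ ℓ) (R ^ k) B ⟩
      2 * suc R * suc ℓ * (B * (R ^ ℓ * R ^ k))
        ≡⟨ cong (λ t → 2 * suc R * suc ℓ * (B * t)) (^-distribˡ-+-* R ℓ k) ⟨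
      2 * suc R * suc ℓ * (B * R ^ (ℓ + k)) ∎

  formula-closed : ∀ ℓ m → formula (suc R) (ℓ + m) ℓ ≡ + riordanEntry ℓ (ℓ + m) / 1
  formula-closed ℓ m = begin
    sumℚ (map (term (suc R) (ℓ + m) ℓ) (upTo (suc (ℓ + m ∸ ℓ))))
      ≡⟨ cong (λ t → sumℚ (map (term (suc R) (ℓ + m) ℓ) (upTo (suc t)))) (m+n∸m≡n ℓ m) ⟩
    sumℚ (map (term (suc R) (ℓ + m) ℓ) (upTo (suc m)))
      ≡⟨ cong sumℚ (List.map-upTo (term (suc R) (ℓ + m) ℓ) (suc m)) ⟩
    sumℚ (applyUpTo (term (suc R) (ℓ + m) ℓ) (suc m))
      ≡⟨ cong sumℚ (applyUpTo-cong (suc m) termwise) ⟩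
    sumℚ (applyUpTo ((λ n → + n / 1) ∘ (λ j → T ℓ j (m ∸ j))) (suc m))
      ≡⟨ cong sumℚ (List.map-applyUpTo (λ j → T ℓ j (m ∸ j)) (λ n → + n / 1) (suc m)) ⟨
    sumℚ (map (λ n → + n / 1) (applyUpTo (λ j → T ℓ j (m ∸ j)) (suc m)))
      ≡⟨ sumℚ-/1 (applyUpTo (λ j → T ℓ j (m ∸ j)) (suc m)) ⟩
    + sum (applyUpTo (λ j → T ℓ j (m ∸ j)) (suc m)) / 1
      ≡⟨ cong (λ t → + t / 1) (∑⁺-applyUpTo m (T ℓ)) ⟩
    + ∑⁺ m (T ℓ) / 1
      ≡⟨ cong (λ t → + t / 1) (∑⁺-*ˡ m (suc R * R ^ ℓ) (λ j k → forests (a ℓ) j k * R ^ k)) ⟩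
    + (suc R * R ^ ℓ * ∑[ j + k ≡ m ] (forests (a ℓ) j k * R ^ k)) / 1
      ≡⟨ cong (λ t → + (suc R * R ^ ℓ * t) / 1)
              (trans (sym (coeff-forests (a ℓ) m)) (sym (coeffˣ-offset ℓ (a ℓ) m))) ⟩
    + riordanEntry ℓ (ℓ + m) / 1 ∎
    where
    termwise : ∀ j → j < suc m → term (suc R) (ℓ + m) ℓ j ≡ + T ℓ j (m ∸ j) / 1
    termwise j j<1+m = subst (λ n → term (suc R) (ℓ + n) ℓ j ≡ + T ℓ j (m ∸ j) / 1)
                             (m+[n∸m]≡n (≤-pred j<1+m)) (term-closed ℓ j (m ∸ j))

theorem5p1 : ∀ (r : ℕ) → 2 ≤ r →
    (∀ (n ℓ : ℕ) → ℓ ≤ n → (+ p r n ℓ) / 1 ≡ formula r n ℓ)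
    × (p r 0 0 ≡ r)
    × (∀ (S : Series) → IsSr r S → ∀ (n ℓ : ℕ) → ℓ ≤ n →
         + p r n ℓ ≡ riordan (scaleS (+ r) (S ⊛ S)) (xS (scaleS (+ (r Data.Nat.∸ 1)) (S ⊛ S))) n ℓ)
theorem5p1 (suc (suc R₀)) (s≤s (s≤s z≤n)) = explicit , initial , riordanArray
  where
  R : ℕ
  R = suc R₀
  explicit : ∀ n ℓ → ℓ ≤ n → + p (suc R) n ℓ / 1 ≡ formula (suc R) n ℓ
  explicit n ℓ ℓ≤n = subst (λ n → + p (suc R) n ℓ / 1 ≡ formula (suc R) n ℓ) (m+[n∸m]≡n ℓ≤n)
    (trans (cong (λ x → + x / 1) (PeakCounting.p-riordanEntry R ℓ (ℓ + (n ∸ ℓ))))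
           (sym (ExplicitFormula.formula-closed R ℓ (n ∸ ℓ))))
  initial : p (suc R) 0 0 ≡ suc R
  initial = trans (PeakCounting.p-riordanEntry R 0 0) (trans (*-identityʳ _) (*-identityʳ _))
  riordanArray : ∀ S → IsSr (suc R) S → ∀ n ℓ → ℓ ≤ n →
    + p (suc R) n ℓ ≡ riordan (scaleS (+ suc R) (S ⊛ S)) (xS (scaleS (+ R) (S ⊛ S))) n ℓ
  riordanArray S S-eq n ℓ _ =
    trans (cong +_ (PeakCounting.p-riordanEntry R ℓ n)) (sym (Solution.riordan-S R S S-eq n ℓ))
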